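{- Let $G$ be a graph and let $Q\subseteq V(G)$ induce a clique in $G$. If there exists a vertex $v\in Q$ with $pn[v,Q]=\emptyset$, then $G$ is not IRC-colorable.
   Context: All graphs are finite, simple, undirected and connected. Private neighbors. For $S\subseteq V(G)$ and $v\in S$, $pn[v,S]=N[v]\setminus\bigcup_{u\in S\setminus\{v\}}N[u]$, where $N[\cdot]$ is the closed neighborhood. $S$ is irredundant if $pn[v,S]\ne\emptyset$ for all $v\in S$. Rainbow committees and IRC-colorings. For a proper coloring of $G$ with nonempty color classes $V_1,\dots,V_k$, a rainbow committee is a set containing exactly one vertex of each color class. An irredundance compelling coloring (IRC-coloring) is a proper coloring in which every rainbow committee is an irredundant set. $G$ is IRC-colorable if it admits an IRC-coloring. -}

module Defs where

open import Data.Nat using (ℕ; suc)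
open import Data.Fin using (Fin)
open import Data.Product using (Σ; ∃; _×_; _,_)
open import Data.Empty using (⊥)
open import Data.Sum using (_⊎_)
open import Relation.Nullary using (¬_)
open import Relation.Unary using (Pred; _∈_; _∉_; Empty)
open import Relation.Binary.PropositionalEquality using (_≡_; _≢_)
open import Level using (0ℓ)

data Reach {n : ℕ} (Adj : Fin n → Fin n → Set) : Fin n → Fin n → Set where
  here  : ∀ {x} → Reach Adj x x
  step  : ∀ {x y z} → Adj x y → Reach Adj y z → Reach Adj x z

record Graph (n : ℕ) : Set₁ where
  field
    Adj       : Fin n → Fin n → Set
    sym       : ∀ {x y} → Adj x y → Adj y x
    irrefl    : ∀ {x} → ¬ Adj x x
    connected : ∀ x y → Reach Adj x y

open Graph public

module _ {n : ℕ} (G : Graph n) where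

  N[_] : Fin n → Pred (Fin n) 0ℓ
  N[ v ] w = (w ≡ v) ⊎ Adj G v w

  pn : Fin n → Pred (Fin n) 0ℓ → Pred (Fin n) 0ℓ
  pn v S w = w ∈ N[ v ] × (∀ u → u ∈ S → u ≢ v → w ∉ N[ u ])

  Irredundant : Pred (Fin n) 0ℓ → Set
  Irredundant S = ∀ v → v ∈ S → ∃ λ w → w ∈ pn v S

  IsClique : Pred (Fin n) 0ℓ → Set
  IsClique Q = ∀ u v → u ∈ Q → v ∈ Q → u ≢ v → Adj G u v

  record ProperColoring (k : ℕ) : Set where
    field
      colour   : Fin n → Fin k
      proper   : ∀ {x y} → Adj G x y → colour x ≢ colour y
      nonempty : ∀ (i : Fin k) → ∃ λ x → colour x ≡ i
  open ProperColoring public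

  IsRainbowCommittee : ∀ {k} → ProperColoring k → Pred (Fin n) 0ℓ → Set
  IsRainbowCommittee {k} c S =
    ∀ (i : Fin k) → ∃ λ x → x ∈ S × colour c x ≡ i
                          × (∀ y → y ∈ S → colour c y ≡ i → y ≡ x)

  IsIRCColoring : ∀ {k} → ProperColoring k → Set₁
  IsIRCColoring c = ∀ (S : Pred (Fin n) 0ℓ) → IsRainbowCommittee c S → Irredundant S

  IRCColorable : Set₁
  IRCColorable = Σ ℕ λ k → Σ (ProperColoring k) IsIRCColoring

{-# OPTIONS --safe #-}
module Submission where

open import Defs hiding (sym)
open import Data.Nat using (ℕ)
open import Data.Fin using (Fin; _≟_)
open import Data.Fin.Properties using (sequence)
open import Data.Product using (Σ; _×_; _,_; ∃; proj₁; proj₂)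
open import Data.Sum using (_⊎_; inj₁; inj₂)
open import Effect.Monad using (RawMonad)
open import Relation.Nullary using (¬_; yes; no)
open import Relation.Nullary.Decidable using (¬¬-excluded-middle)
open import Relation.Nullary.Negation using (DoubleNegation; ¬¬-Monad; contradiction)
open import Relation.Unary using (Pred; _∈_; _∉_; _⊆_; Empty; Decidable)
open import Relation.Binary.PropositionalEquality using (_≡_; trans; sym; cong; subst)
open import Level using (0ℓ)

-- The colours used on Q are distinct, so Q extends to a rainbow committee S by one
-- representative of each colour missed by Q.  Enlarging a set only shrinks private
-- neighbourhoods, so v still has none in S, and S is not irredundant.  Which colours
-- Q uses is not decidable for an arbitrary predicate Q, but the goal is ⊥ and there
-- are finitely many colours, so excluded middle for each of them may be assumed.

¬¬-decidable : ∀ {k} (P : Pred (Fin k) 0ℓ) → DoubleNegation (Decidable P)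
¬¬-decidable P = sequence (RawMonad.rawApplicative ¬¬-Monad) (λ _ → ¬¬-excluded-middle)

module _ {n : ℕ} (G : Graph n) where

  pn-antitone : ∀ {S T : Pred (Fin n) 0ℓ} {v} → S ⊆ T → pn G v T ⊆ pn G v S
  pn-antitone S⊆T (w∈N[v] , unshared) = w∈N[v] , λ u u∈S → unshared u (S⊆T u∈S)

  module _ {k : ℕ} (c : ProperColoring G k) where

    clique⇒colour-injective : ∀ {Q} → IsClique G Q →
      ∀ {x y} → x ∈ Q → y ∈ Q → colour c x ≡ colour c y → x ≡ y
    clique⇒colour-injective clique {x} {y} x∈Q y∈Q same with x ≟ y
    ... | yes x≡y = x≡y
    ... | no  x≢y = contradiction same (proper c (clique x y x∈Q y∈Q x≢y))

    ColoursOf : Pred (Fin n) 0ℓ → Pred (Fin k) 0ℓ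
    ColoursOf Q i = ∃ λ q → q ∈ Q × colour c q ≡ i

    representative : Fin k → Fin n
    representative i = proj₁ (nonempty c i)

    representative-colour : ∀ i → colour c (representative i) ≡ i
    representative-colour i = proj₂ (nonempty c i)

    completion : Pred (Fin n) 0ℓ → Pred (Fin n) 0ℓ
    completion Q x = x ∈ Q ⊎ (x ≡ representative (colour c x) × colour c x ∉ ColoursOf Q)

    ⊆-completion : ∀ {Q} → Q ⊆ completion Q
    ⊆-completion = inj₁

    completion-rainbow : ∀ {Q} →
      (∀ {x y} → x ∈ Q → y ∈ Q → colour c x ≡ colour c y → x ≡ y) →
      Decidable (ColoursOf Q) → IsRainbowCommittee G c (completion Q)
    completion-rainbow {Q} injective used? i with used? i
    ... | yes (q , q∈Q , q↦i) = q , inj₁ q∈Q , q↦i , unique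
      where
      unique : ∀ y → y ∈ completion Q → colour c y ≡ i → y ≡ q
      unique y (inj₁ y∈Q)       y↦i = injective y∈Q q∈Q (trans y↦i (sym q↦i))
      unique y (inj₂ (_ , free)) y↦i = contradiction (q , q∈Q , trans q↦i (sym y↦i)) free
    ... | no free = r , inj₂ (r-chosen , r-free) , representative-colour i , unique
      where
      r = representative i
      r-chosen : r ≡ representative (colour c r)
      r-chosen = cong representative (sym (representative-colour i))
      r-free : colour c r ∉ ColoursOf Q
      r-free = subst (_∉ ColoursOf Q) (sym (representative-colour i)) free
      unique : ∀ y → y ∈ completion Q → colour c y ≡ i → y ≡ r
      unique y (inj₁ y∈Q)            y↦i = contradiction (y , y∈Q , y↦i) free
      unique y (inj₂ (y-chosen , _)) y↦i = trans y-chosen (cong representative y↦i)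

proposition5 : ∀ {n : ℕ} (G : Graph n) (Q : Pred (Fin n) 0ℓ) →
    IsClique G Q →
    Σ (Fin n) (λ v → v ∈ Q × Empty (pn G v Q)) →
    ¬ IRCColorable G
proposition5 G Q clique (v , v∈Q , no-private) (k , c , irc) =
  ¬¬-decidable (ColoursOf G c Q) λ used? →
    let S = completion G c Q
        rainbow = completion-rainbow G c (clique⇒colour-injective G c clique) used?
        (w , w∈pn) = irc S rainbow v (⊆-completion G c v∈Q)
    in no-private w (pn-antitone G (⊆-completion G c) w∈pn)
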